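{- Let $p$ be a prime and let $n=p^m$ for some nonnegative integer $m$. Then $p$ divides the Narayana number $N(n,k)=\frac{1}{n}\binom{n}{k}\binom{n}{k+1}$ for every integer $k$ with $1\le k\le n-2$. -}

module Defs where

open import Data.Nat using (ℕ; suc; _*_; _/_; NonZero)
open import Data.Nat.Combinatorics using (_C_)

-- Narayana number N(n,k) = (1/n) * C(n,k) * C(n,k+1), for n ≥ 1.
-- The product C(n,k) * C(n,k+1) is always divisible by n, so the
-- truncated natural-number division below is exact.
narayana : (n : ℕ) → .{{NonZero n}} → ℕ → ℕ
narayana n k = ((n C k) * (n C suc k)) / n

{-# OPTIONS --safe #-}
module Submission where

open import Defs
open import Data.Nat using (ℕ; _^_; _≤_; _∸_; NonZero)
open import Data.Nat.Divisibility using (_∣_)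
open import Data.Nat.Primality using (Prime)

open import Data.Nat.Base using (zero; suc; _+_; _*_; _<_; z≤n; s≤s; >-nonZero; nonTrivial⇒≢1)
open import Data.Nat.Properties
  using (*-comm; *-assoc; *-zeroʳ; *-identityˡ; *-identityʳ; *-distribˡ-+; +-assoc; +-comm; <⇒≱; ≤-trans; n≤1+n)
open import Data.Nat.Divisibility
  using (_∤_; divides; divides-refl; _∣?_; ∣-refl; ∣-trans; 1∣_; ∣1⇒≡1; m∣m*n; ∣n⇒∣m*n; ∣⇒≤; ∣m+n∣m⇒∣n;
         *-pres-∣; *-monoˡ-∣; *-cancelʳ-∣; m*n∣o⇒m∣o/n; m*n∣o⇒n∣o/m)
open import Data.Nat.Primality using (euclidsLemma; prime⇒nonZero; prime⇒nonTrivial)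
open import Data.Nat.Combinatorics using (_C_; nC1≡n; nCk+nC[k+1]≡[n+1]C[k+1])
open import Data.Sum using (inj₁; inj₂)
open import Relation.Nullary using (Dec; yes; no; contradiction)
open import Relation.Binary.PropositionalEquality
  using (_≡_; refl; sym; trans; cong; cong₂; subst; subst₂; module ≡-Reasoning)

-- Absorption, k C(n,k) = n C(n-1,k-1), gives n ∣ k C(n,k).  For n = p^m this
-- forces p ∣ C(n,j) whenever 0 < j < n (otherwise p^m ∣ j), and n ∣ C(n,j)
-- whenever p ∤ j.  Since p cannot divide both k and k+1, one of C(n,k) and
-- C(n,k+1) absorbs the factor n and the other contributes a factor p to
-- N(n,k) = C(n,k) C(n,k+1) / n.

[k+1]*[n+1]C[k+1]≡[n+1]*nCk : ∀ n k → suc k * (suc n C suc k) ≡ suc n * (n C k)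
[k+1]*[n+1]C[k+1]≡[n+1]*nCk zero    zero    = refl
[k+1]*[n+1]C[k+1]≡[n+1]*nCk zero    (suc k) = *-zeroʳ (suc (suc k))
[k+1]*[n+1]C[k+1]≡[n+1]*nCk (suc n) zero    =
  trans (*-identityˡ _) (trans (nC1≡n (suc (suc n))) (sym (*-identityʳ (suc (suc n)))))
[k+1]*[n+1]C[k+1]≡[n+1]*nCk (suc n) (suc k) = begin
  suc (suc k) * (suc n+1 C suc (suc k))
    ≡⟨ cong (suc (suc k) *_) (nCk+nC[k+1]≡[n+1]C[k+1] n+1 (suc k)) ⟨
  suc (suc k) * (a + b)
    ≡⟨ *-distribˡ-+ (suc (suc k)) a b ⟩
  (a + suc k * a) + suc (suc k) * b
    ≡⟨ cong₂ (λ u v → (a + u) + v) ([k+1]*[n+1]C[k+1]≡[n+1]*nCk n k)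
                                   ([k+1]*[n+1]C[k+1]≡[n+1]*nCk n (suc k)) ⟩
  (a + n+1 * (n C k)) + n+1 * (n C suc k)
    ≡⟨ +-assoc a _ _ ⟩
  a + (n+1 * (n C k) + n+1 * (n C suc k))
    ≡⟨ cong (a +_) (*-distribˡ-+ n+1 (n C k) (n C suc k)) ⟨
  a + n+1 * (n C k + n C suc k)
    ≡⟨ cong (λ c → a + n+1 * c) (nCk+nC[k+1]≡[n+1]C[k+1] n k) ⟩
  a + n+1 * a
    ∎
  where
  open ≡-Reasoning
  n+1 = suc n
  a = n+1 C suc k
  b = n+1 C suc (suc k)

n∣k*nCk : ∀ n k → n ∣ k * (n C k)
n∣k*nCk n       zero    = divides 0 refl
n∣k*nCk zero    (suc k) = ∣n⇒∣m*n (suc k) ∣-refl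
n∣k*nCk (suc n) (suc k) = divides (n C k) (trans ([k+1]*[n+1]C[k+1]≡[n+1]*nCk n k) (*-comm (suc n) (n C k)))

p^i∣m*n∧p∤m⇒p^i∣n : ∀ {p m n} → Prime p → ∀ i → p ^ i ∣ m * n → p ∤ m → p ^ i ∣ n
p^i∣m*n∧p∤m⇒p^i∣n {n = n} pr zero    _       _   = 1∣ n
p^i∣m*n∧p∤m⇒p^i∣n {p} {m} {n} pr (suc i) p^[1+i]∣mn p∤m
  with euclidsLemma m n pr (∣-trans (m∣m*n (p ^ i)) p^[1+i]∣mn)
... | inj₁ p∣m               = contradiction p∣m p∤m
... | inj₂ (divides-refl q) = subst (_∣ q * p) (*-comm (p ^ i) p) (*-monoˡ-∣ p p^i∣q)
  where
  instance _ = prime⇒nonZero pr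
  p^i∣q : p ^ i ∣ q
  p^i∣q = p^i∣m*n∧p∤m⇒p^i∣n pr i
    (*-cancelʳ-∣ p (subst₂ _∣_ (*-comm p (p ^ i)) (sym (*-assoc m q p)) p^[1+i]∣mn)) p∤m

p^i∣[p^i]Cj : ∀ {p j} → Prime p → ∀ i → p ∤ j → p ^ i ∣ (p ^ i) C j
p^i∣[p^i]Cj {p} {j} pr i p∤j = p^i∣m*n∧p∤m⇒p^i∣n pr i (n∣k*nCk (p ^ i) j) p∤j

p∣[p^i]Ck : ∀ {p k} → Prime p → ∀ i → 0 < k → k < p ^ i → p ∣ (p ^ i) C k
p∣[p^i]Ck {p} {k} pr i 0<k k<p^i with p ∣? (p ^ i) C k
... | yes p∣C = p∣C
... | no  p∤C = contradiction (∣⇒≤ {{>-nonZero 0<k}} p^i∣k) (<⇒≱ k<p^i)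
  where
  p^i∣k : p ^ i ∣ k
  p^i∣k = p^i∣m*n∧p∤m⇒p^i∣n pr i (subst (p ^ i ∣_) (*-comm k _) (n∣k*nCk (p ^ i) k)) p∤C

p∣n⇒p∤1+n : ∀ {p n} → Prime p → p ∣ n → p ∤ suc n
p∣n⇒p∤1+n {p} {n} pr p∣n p∣1+n =
  nonTrivial⇒≢1 {{prime⇒nonTrivial pr}} (∣1⇒≡1 (∣m+n∣m⇒∣n (subst (p ∣_) (+-comm 1 n) p∣1+n) p∣n))

1≤m≤n∸2⇒2+m≤n : ∀ {m n} → 1 ≤ m → m ≤ n ∸ 2 → 2 + m ≤ n
1≤m≤n∸2⇒2+m≤n {n = suc (suc n)} _ m≤n = s≤s (s≤s m≤n)
1≤m≤n∸2⇒2+m≤n {n = 0} (s≤s _) ()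
1≤m≤n∸2⇒2+m≤n {n = 1} (s≤s _) ()

corollary2p2 : (p m : ℕ) → (pr : Prime p) → .{{_ : NonZero (p ^ m)}} →
    (k : ℕ) → 1 ≤ k → k ≤ p ^ m ∸ 2 → p ∣ narayana (p ^ m) k
corollary2p2 p m pr k 1≤k k≤n∸2 = by-cases (p ∣? k)
  where
  n = p ^ m
  2+k≤n : 2 + k ≤ n
  2+k≤n = 1≤m≤n∸2⇒2+m≤n 1≤k k≤n∸2
  by-cases : Dec (p ∣ k) → p ∣ narayana n k
  by-cases (no p∤k)  = m*n∣o⇒n∣o/m n p
    (*-pres-∣ (p^i∣[p^i]Cj pr m p∤k) (p∣[p^i]Ck pr m (s≤s z≤n) 2+k≤n))
  by-cases (yes p∣k) = m*n∣o⇒m∣o/n p n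
    (*-pres-∣ (p∣[p^i]Ck pr m 1≤k (≤-trans (n≤1+n _) 2+k≤n)) (p^i∣[p^i]Cj pr m (p∣n⇒p∤1+n pr p∣k)))
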